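{- There exists an unbounded string multiway system whose growth function $a$ has tight bounds $(f,g)$ with $f\in\Theta(x^2)$ and $g\in\Theta(x)$, where $f$ is the upper and $g$ the lower tight bound; in particular the system is strongly oscillating (not regular).
   Context: A (string) multiway system is a triple $(R,s_{\text{init}},\Sigma)$: a finite alphabet $\Sigma$, a finite set $R$ of replacement rules $r\to t$ with $r,t\in\Sigma^*$, and an initial string $s_{\text{init}}\in\Sigma^*$. Its states graph has as vertices the strings reachable from $s_{\text{init}}$, with an edge $u\to v$ if $v$ arises from $u$ by replacing one occurrence of some $r$ by $t$. The growth function $a(n)$ is the number of states first appearing in generation $n$ (generation 1 is $\{s_{\text{init}}\}$, generation $n$ the states at shortest-path distance $n-1$). The system is unbounded if $a(n)\neq0$ for all $n$ and $a$ is unbounded. The linear interpolation $L_{\mathbb{N}_+}(h)$ is the polygonal chain from $(0,0)$ through the points $(n,h(n))$, $n\in\mathbb{N}_+$. With $\overline a_n=\max\{a_k:k\le n\}$ and $\underline a_n=\max(\{a_k:k\le n,\ \forall l\ge k: a_l\ge a_k\}\cup\{1\})$, continuous functions $f,g:\mathbb{R}_{\ge0}\to\mathbb{R}_{\ge0}$ are (upper and lower) tight bounds if $f\in\Theta(L_{\mathbb{N}_+}(\overline a))$ and $g\in\Theta(L_{\mathbb{N}_+}(\underline a))$. An unbounded system is regular if its tight bounds are asymptotically equal, and strongly oscillating otherwise. -}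

module Defs where

open import Data.Nat using (ℕ; zero; suc; _+_; _*_; _≤_; _<_; _⊔_)
open import Data.Fin using (Fin)
open import Data.List using (List; []; _∷_; _++_; length)
open import Data.List.Membership.Propositional using (_∈_)
open import Data.List.Relation.Unary.Unique.Propositional using (Unique)
open import Data.Product using (Σ; ∃; _×_; _,_)
open import Data.Empty using (⊥)
open import Relation.Binary.PropositionalEquality using (_≡_)
open import Relation.Nullary using (¬_)
open import Function.Bundles using (_⇔_)

record MultiwaySystem : Set where
  field
    k     : ℕ
    rules : List (List (Fin k) × List (Fin k))
    init  : List (Fin k)

module _ (S : MultiwaySystem) where
  open MultiwaySystem S

  Str : Set
  Str = List (Fin k)

  Step : Str → Str → Set
  Step u v = Σ (List (Fin k) × List (Fin k)) λ rt → rt ∈ rules ×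
             (Σ Str λ x → Σ Str λ y →
               let (r , t) = rt in (u ≡ x ++ (r ++ y)) × (v ≡ x ++ (t ++ y)))

  ReachIn : ℕ → Str → Set
  ReachIn zero v = v ≡ init
  ReachIn (suc n) v = Σ Str λ u → ReachIn n u × Step u v

  -- generation n (1-indexed): states at shortest-path distance n-1;
  -- generation 0 is empty (convention, so a 0 = 0)
  Gen : ℕ → Str → Set
  Gen zero v = ⊥
  Gen (suc n) v = ReachIn n v × (∀ m → m < n → ¬ ReachIn m v)

  IsGrowthFunction : (ℕ → ℕ) → Set
  IsGrowthFunction a = ∀ n → Σ (List Str) λ xs →
    Unique xs × (∀ v → (v ∈ xs) ⇔ Gen n v) × (length xs ≡ a n)

UnboundedSeq : (ℕ → ℕ) → Set
UnboundedSeq a = (∀ n → ¬ (a (suc n) ≡ 0)) × (∀ B → ∃ λ n → B < a n)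

upperEnv : (ℕ → ℕ) → ℕ → ℕ
upperEnv a zero = a zero
upperEnv a (suc n) = upperEnv a n ⊔ a (suc n)

InLowerSet : (ℕ → ℕ) → ℕ → ℕ → Set
InLowerSet a n x = (x ≡ 1) ⊎' (Σ ℕ λ j → 1 ≤ j × j ≤ n × (∀ l → j ≤ l → a j ≤ a l) × x ≡ a j)
  where
  open import Data.Sum using () renaming (_⊎_ to _⊎'_)

IsLowerEnv : (ℕ → ℕ) → ℕ → ℕ → Set
IsLowerEnv a n m = InLowerSet a n m × (∀ x → InLowerSet a n x → x ≤ m)

ThetaPow : (ℕ → ℕ) → ℕ → Set
ThetaPow h e = Σ ℕ λ c → Σ ℕ λ C → Σ ℕ λ N → ∀ n → N ≤ n →
  (n ^' e ≤ c * h n) × (h n ≤ C * n ^' e)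
  where
  open import Data.Nat using () renaming (_^_ to _^'_)

-- Two components grow from I. The strings a^i W b^j with i + j = t make up
-- t + 1 strings of generation t + 2, so a(n) ≥ n. In the other component a
-- head R sweeps right through S w R a^r E, turning at most two letters a into b
-- (the head R₀, R₁, R₂ remembers how many), so p steps into a sweep there are
-- 1 + p + C(p,2) such strings. At E the head becomes L and sweeps back doubling
-- each letter into aa; this merges all strings into a single one, and the next
-- right sweep starts at S on a block twice as long. A cycle of size s lasts
-- 2s + 2 steps and sizes double, so at every time n the current or previous
-- peak has size comparable to n (upper envelope Θ(n²)), while the single-string
-- troughs where a(n) = n recur at geometrically spaced times (lower envelope Θ(n)).
module Submission where

open import Defs
open import Data.Nat using (ℕ; suc)
open import Data.Product using (Σ; _×_)
open import Data.Nat using (zero; _+_; _*_; _^_; _≤_; _<_; _⊔_; _≤?_; z≤n; s≤s; s≤s⁻¹)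
open import Data.Nat.Properties
open import Data.Nat.Combinatorics using (_C_; nC1≡n; nCk+nC[k+1]≡[n+1]C[k+1])
open import Data.Nat.Tactic.RingSolver using (solve-∀)
open import Data.Fin using (Fin; zero; suc)
import Data.Fin.Properties as Fin
open import Data.List using (List; []; _∷_; [_]; _++_; _∷ʳ_; map; replicate; length)
open import Data.List.Properties
  using (++-cancelʳ; ∷-injective; ∷-injectiveʳ; ++-identityʳ; ++-assoc; ∷ʳ-++; ∷ʳ-injectiveˡ; ∷ʳ-injectiveʳ)
import Data.List.Properties as List
open import Data.List.Membership.Propositional using (_∈_)
open import Data.List.Membership.Propositional.Properties using (∈-map⁻; ∈-map⁺; ∈-++⁻; ∈-++⁺ˡ; ∈-++⁺ʳ)
open import Data.List.Relation.Unary.All using (All; []; _∷_; head)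
import Data.List.Relation.Unary.All.Properties as All
import Data.List.Relation.Unary.AllPairs as AllPairs
open import Data.List.Relation.Unary.Any using (here)
open import Data.List.Relation.Unary.Unique.Propositional using (Unique)
import Data.List.Relation.Unary.Unique.Propositional.Properties as Unique
open import Data.Product using (_,_; ∃; proj₁; proj₂; map₁; map₂)
import Data.Product.Properties as Product
open import Data.Sum using (_⊎_; inj₁; inj₂)
import Data.Sum as Sum
open import Data.Empty using (⊥; ⊥-elim)
open import Data.Unit using (⊤; tt)
open import Function using (_∘_)
open import Function.Bundles using (mk⇔)
open import Relation.Binary.Definitions using (tri<; tri≈; tri>)
open import Relation.Binary.PropositionalEquality
  using (_≡_; _≢_; refl; sym; trans; cong; cong₂; subst; subst₂; module ≡-Reasoning)
open import Relation.Nullary using (¬_; contradiction; Dec; yes; no)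
open import Relation.Nullary.Decidable using (True; toWitness; map′; _→-dec_)
open import Relation.Unary using (_≐_; _∪_; _⊆_)

split-unique : ∀ {X : Set} {P : X → Set} (xs : List X) {x ys} (xs′ : List X) {x′ ys′} →
               ¬ P x → All P xs′ → All P ys′ →
               xs ++ x ∷ ys ≡ xs′ ++ x′ ∷ ys′ → xs ≡ xs′ × x ≡ x′ × ys ≡ ys′
split-unique []       []        ¬Px _           _    refl = refl , refl , refl
split-unique []       (_ ∷ xs′) ¬Px (Px ∷ _)    _    refl = ⊥-elim (¬Px Px)
split-unique (_ ∷ xs) []        ¬Px _           Pys′ refl = ⊥-elim (¬Px (head (All.++⁻ʳ xs Pys′)))
split-unique (_ ∷ xs) (_ ∷ xs′) ¬Px (_ ∷ Pxs′) Pys′ eq with refl , eq′ ← ∷-injective eq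
  with refl , refl , refl ← split-unique xs xs′ ¬Px Pxs′ Pys′ eq′ = refl , refl , refl

replicate-++-∷ : ∀ {X : Set} n (x : X) ys → replicate n x ++ x ∷ ys ≡ x ∷ replicate n x ++ ys
replicate-++-∷ zero    x ys = refl
replicate-++-∷ (suc n) x ys = cong (x ∷_) (replicate-++-∷ n x ys)

replicate-injective : ∀ {X : Set} {m n} (x : X) → replicate m x ≡ replicate n x → m ≡ n
replicate-injective {m = m} {n} x eq = trans (sym (List.length-replicate m)) (trans (cong length eq) (List.length-replicate n))

drop-[] : ∀ {X : Set} {u x : List X} → u ≡ x ++ [] → x ≡ u
drop-[] {x = x} eq = sym (trans eq (++-identityʳ x))

Enumerates : ∀ {X : Set} → (X → Set) → List X → Set
Enumerates P xs = Unique xs × (_∈ xs) ≐ P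

module _ {X : Set} {P Q : X → Set} {xs : List X} where

  enumerates-≐ : P ≐ Q → Enumerates P xs → Enumerates Q xs
  enumerates-≐ (P⊆Q , Q⊆P) (uniq , sound , complete) = uniq , P⊆Q ∘ sound , complete ∘ Q⊆P

  enumerates-++ : ∀ {ys} → Enumerates P xs → Enumerates Q ys → (∀ {x} → P x → ¬ Q x) →
                  Enumerates (P ∪ Q) (xs ++ ys)
  enumerates-++ (uniq₁ , sound₁ , complete₁) (uniq₂ , sound₂ , complete₂) disjoint =
    Unique.++⁺ uniq₁ uniq₂ (λ (x∈xs , x∈ys) → disjoint (sound₁ x∈xs) (sound₂ x∈ys)) ,
    Sum.map sound₁ sound₂ ∘ ∈-++⁻ xs ,
    Sum.[ ∈-++⁺ˡ ∘ complete₁ , ∈-++⁺ʳ xs ∘ complete₂ ]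

Image : ∀ {X Y : Set} → (X → Y) → (X → Set) → Y → Set
Image f P y = ∃ λ x → P x × y ≡ f x

module _ {X Y : Set} {P : X → Set} {xs : List X} where

  enumerates-map : (f : X → Y) → (∀ {x x′} → f x ≡ f x′ → x ≡ x′) → Enumerates P xs →
                   Enumerates (Image f P) (map f xs)
  enumerates-map f f-injective (uniq , sound , complete) =
    Unique.map⁺ f-injective uniq ,
    map₂ (map₁ sound) ∘ ∈-map⁻ f ,
    λ { (_ , Px , refl) → ∈-map⁺ f (complete Px) }

enumerates-singleton : ∀ {X : Set} {x : X} → Enumerates (_≡ x) [ x ]
enumerates-singleton = [] AllPairs.∷ AllPairs.[] , (λ { (here refl) → refl }) , λ { refl → here refl }

enumerates-[] : ∀ {X : Set} {P : X → Set} → (∀ {x} → ¬ P x) → Enumerates P []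
enumerates-[] ¬P = AllPairs.[] , (λ ()) , λ Px → contradiction Px ¬P

≤-balance : ∀ {a b} A B c → a ≤ b → A + b + c ≡ B + a → A ≤ B
≤-balance {a} {b} A B c a≤b eq = +-cancelʳ-≤ a A B (begin
  A + a      ≤⟨ +-monoʳ-≤ A a≤b ⟩
  A + b      ≤⟨ m≤m+n (A + b) c ⟩
  A + b + c  ≡⟨ eq ⟩
  B + a      ∎)
  where open ≤-Reasoning

module _ (f : ℕ → ℕ) (f↑ : ∀ n → f n < f (suc n)) where

  increasing⇒strictlyMonotone : ∀ {m n} → m < n → f m < f n
  increasing⇒strictlyMonotone {m} {suc n} m<1+n with m≤n⇒m<n∨m≡n (s≤s⁻¹ m<1+n)
  ... | inj₁ m<n  = <-trans (increasing⇒strictlyMonotone m<n) (f↑ n)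
  ... | inj₂ refl = f↑ n

  increasing⇒injective : ∀ {m n} → f m ≡ f n → m ≡ n
  increasing⇒injective {m} {n} eq with <-cmp m n
  ... | tri< m<n _ _ = contradiction eq (<⇒≢ (increasing⇒strictlyMonotone m<n))
  ... | tri≈ _ m≡n _ = m≡n
  ... | tri> _ _ n<m = contradiction (sym eq) (<⇒≢ (increasing⇒strictlyMonotone n<m))

≤-upperEnv : ∀ a {j} n → j ≤ n → a j ≤ upperEnv a n
≤-upperEnv a zero    z≤n   = ≤-refl
≤-upperEnv a (suc n) j≤1+n with m≤n⇒m<n∨m≡n j≤1+n
... | inj₁ j<1+n = ≤-trans (≤-upperEnv a n (s≤s⁻¹ j<1+n)) (m≤m⊔n (upperEnv a n) (a (suc n)))
... | inj₂ refl  = m≤n⊔m (upperEnv a n) (a (suc n))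

upperEnv-least : ∀ a n {B} → (∀ j → j ≤ n → a j ≤ B) → upperEnv a n ≤ B
upperEnv-least a zero    bound = bound 0 z≤n
upperEnv-least a (suc n) bound =
  ⊔-lub (upperEnv-least a n (λ j j≤n → bound j (m≤n⇒m≤1+n j≤n))) (bound (suc n) ≤-refl)

ForwardMinimum : (ℕ → ℕ) → ℕ → Set
ForwardMinimum a j = ∀ l → j ≤ l → a j ≤ a l

module LowerEnvelope (a : ℕ → ℕ) (n≤a : ∀ n → n ≤ a n) where

  -- Every l > a j satisfies a j < l ≤ a l, so only l ≤ a j need to be checked.
  forwardMinimum? : ∀ j → Dec (ForwardMinimum a j)
  forwardMinimum? j = map′ extend restrict (allUpTo? (λ l → j ≤? l →-dec a j ≤? a l) (suc (a j)))
    where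
    extend : (∀ {l} → l < suc (a j) → j ≤ l → a j ≤ a l) → ForwardMinimum a j
    extend below l j≤l with l ≤? a j
    ... | yes l≤aj = below (s≤s l≤aj) j≤l
    ... | no  l≰aj = ≤-trans (<⇒≤ (≰⇒> l≰aj)) (n≤a l)
    restrict : ForwardMinimum a j → ∀ {l} → l < suc (a j) → j ≤ l → a j ≤ a l
    restrict fm {l} _ = fm l

  lowerEnv : ℕ → ℕ
  lowerEnv zero = 1
  lowerEnv (suc n) with forwardMinimum? (suc n)
  ... | yes _ = lowerEnv n ⊔ a (suc n)
  ... | no  _ = lowerEnv n

  lowerEnv-mono : ∀ n → lowerEnv n ≤ lowerEnv (suc n)
  lowerEnv-mono n with forwardMinimum? (suc n)
  ... | yes _ = m≤m⊔n (lowerEnv n) (a (suc n))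
  ... | no  _ = ≤-refl

  1≤lowerEnv : ∀ n → 1 ≤ lowerEnv n
  1≤lowerEnv zero    = ≤-refl
  1≤lowerEnv (suc n) = ≤-trans (1≤lowerEnv n) (lowerEnv-mono n)

  InLowerSet-suc : ∀ {n x} → InLowerSet a n x → InLowerSet a (suc n) x
  InLowerSet-suc (inj₁ x≡1)                     = inj₁ x≡1
  InLowerSet-suc (inj₂ (j , 1≤j , j≤n , fm , x≡aj)) = inj₂ (j , 1≤j , m≤n⇒m≤1+n j≤n , fm , x≡aj)

  lowerEnv-∈ : ∀ n → InLowerSet a n (lowerEnv n)
  lowerEnv-∈ zero = inj₁ refl
  lowerEnv-∈ (suc n) with forwardMinimum? (suc n)
  ... | no  _ = InLowerSet-suc (lowerEnv-∈ n)
  ... | yes fm with ⊔-sel (lowerEnv n) (a (suc n))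
  ...   | inj₁ eq = subst (InLowerSet a (suc n)) (sym eq) (InLowerSet-suc (lowerEnv-∈ n))
  ...   | inj₂ eq = subst (InLowerSet a (suc n)) (sym eq) (inj₂ (suc n , s≤s z≤n , ≤-refl , fm , refl))

  lowerEnv-max : ∀ n x → InLowerSet a n x → x ≤ lowerEnv n
  lowerEnv-max n _ (inj₁ refl) = 1≤lowerEnv n
  lowerEnv-max zero _ (inj₂ (zero  , ()  , _))
  lowerEnv-max zero _ (inj₂ (suc _ , _ , () , _))
  lowerEnv-max (suc n) _ (inj₂ (j , 1≤j , j≤1+n , fm , refl)) with m≤n⇒m<n∨m≡n j≤1+n
  ... | inj₁ j<1+n = ≤-trans (lowerEnv-max n _ (inj₂ (j , 1≤j , s≤s⁻¹ j<1+n , fm , refl))) (lowerEnv-mono n)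
  ... | inj₂ refl with forwardMinimum? (suc n)
  ...   | yes _  = m≤n⊔m (lowerEnv n) (a (suc n))
  ...   | no ¬fm = contradiction fm ¬fm

  lowerEnv-isLowerEnv : ∀ n → IsLowerEnv a n (lowerEnv n)
  lowerEnv-isLowerEnv n = lowerEnv-∈ n , lowerEnv-max n

fixedPoint≤lowerEnv : ∀ {a n m j} → (∀ n → n ≤ a n) → IsLowerEnv a n m → 1 ≤ j → j ≤ n → a j ≡ j → j ≤ m
fixedPoint≤lowerEnv {a} {m = m} {j} n≤a (_ , max) 1≤j j≤n aj≡j =
  subst (_≤ m) aj≡j (max (a j) (inj₂ (j , 1≤j , j≤n , forwardMinimum , refl)))
  where
  forwardMinimum : ForwardMinimum a j
  forwardMinimum l j≤l = subst (_≤ a l) (sym aj≡j) (≤-trans j≤l (n≤a l))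

lowerEnv≤fixedPoint : ∀ {a n m j} → IsLowerEnv a n m → 1 ≤ n → n ≤ j → a j ≡ j → m ≤ j
lowerEnv≤fixedPoint (inj₁ refl , _) 1≤n n≤j _ = ≤-trans 1≤n n≤j
lowerEnv≤fixedPoint {j = j} (inj₂ (i , _ , i≤n , fm , refl) , _) _ n≤j aj≡j =
  subst (_ ≤_) aj≡j (fm j (≤-trans i≤n n≤j))

2*[nC2]+n≡n*n : ∀ n → 2 * (n C 2) + n ≡ n * n
2*[nC2]+n≡n*n zero    = refl
2*[nC2]+n≡n*n (suc n) = begin
  2 * (suc n C 2) + suc n        ≡⟨ cong (λ c → 2 * c + suc n) (nCk+nC[k+1]≡[n+1]C[k+1] n 1) ⟨
  2 * (n C 1 + n C 2) + suc n    ≡⟨ cong (λ c → 2 * (c + n C 2) + suc n) (nC1≡n n) ⟩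
  2 * (n + n C 2) + suc n        ≡⟨ regroup n (n C 2) ⟩
  (2 * (n C 2) + n) + 2 * n + 1  ≡⟨ cong (λ m → m + 2 * n + 1) (2*[nC2]+n≡n*n n) ⟩
  n * n + 2 * n + 1              ≡⟨ square n ⟩
  suc n * suc n                  ∎
  where
  regroup : ∀ n c → 2 * (n + c) + suc n ≡ (2 * c + n) + 2 * n + 1
  regroup = solve-∀
  square : ∀ n → n * n + 2 * n + 1 ≡ suc n * suc n
  square = solve-∀
  open ≡-Reasoning

choose≤2 : ℕ → ℕ
choose≤2 p = p C 0 + (p C 1 + p C 2)

2*choose≤2 : ∀ n → 2 * choose≤2 n ≡ n * n + n + 2
2*choose≤2 n = begin
  2 * (1 + (n C 1 + n C 2))  ≡⟨ cong (λ c → 2 * (1 + (c + n C 2))) (nC1≡n n) ⟩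
  2 * (1 + (n + n C 2))      ≡⟨ regroup n (n C 2) ⟩
  (2 * (n C 2) + n) + n + 2  ≡⟨ cong (λ m → m + n + 2) (2*[nC2]+n≡n*n n) ⟩
  n * n + n + 2            ∎
  where
  regroup : ∀ n c → 2 * (1 + (n + c)) ≡ (2 * c + n) + n + 2
  regroup = solve-∀
  open ≡-Reasoning

square≤2*choose≤2 : ∀ n → n * n ≤ 2 * choose≤2 n
square≤2*choose≤2 n = begin
  n * n            ≤⟨ m≤m+n (n * n) (n + 2) ⟩
  n * n + (n + 2)  ≡⟨ +-assoc (n * n) n 2 ⟨
  n * n + n + 2    ≡⟨ 2*choose≤2 n ⟨
  2 * choose≤2 n   ∎
  where open ≤-Reasoning

choose≤2-bound : ∀ {m n} → m ≤ n → choose≤2 m ≤ n * n + n + 2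
choose≤2-bound {m} {n} m≤n = begin
  choose≤2 m      ≤⟨ m≤m+n (choose≤2 m) (choose≤2 m + 0) ⟩
  2 * choose≤2 m  ≡⟨ 2*choose≤2 m ⟩
  m * m + m + 2   ≤⟨ +-monoˡ-≤ 2 (+-mono-≤ (*-mono-≤ m≤n m≤n) m≤n) ⟩
  n * n + n + 2   ∎
  where open ≤-Reasoning

-- Phases of the main component

-- sweepR p r : the head R has p letters of its word to its left and r letters a to its right.
-- sweepL σ r : the head L has r letters to its left and has already doubled σ letters.
data Phase : Set where
  sweepR sweepL : ℕ → ℕ → Phase

double : ℕ → ℕ
double zero    = zero
double (suc n) = suc (suc (double n))

next : Phase → Phase
next (sweepR p (suc r)) = sweepR (suc p) r
next (sweepR p zero)    = sweepL zero p
next (sweepL σ (suc r)) = sweepL (suc σ) r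
next (sweepL σ zero)    = sweepR zero (double σ)

phase : ℕ → Phase
phase zero    = sweepR 0 2
phase (suc t) = next (phase t)

size : Phase → ℕ
size (sweepR p r) = p + r
size (sweepL σ r) = σ + r

elapsed : Phase → ℕ
elapsed (sweepR p r) = p
elapsed (sweepL σ r) = suc (σ + σ + r)

wordLength : Phase → ℕ
wordLength (sweepR p r) = p
wordLength (sweepL σ r) = r

mainCount : Phase → ℕ
mainCount d = choose≤2 (wordLength d)

double≡+ : ∀ n → double n ≡ n + n
double≡+ zero    = refl
double≡+ (suc n) = cong suc (trans (cong suc (double≡+ n)) (sym (+-suc n n)))

double-injective : ∀ {m n} → double m ≡ double n → m ≡ n
double-injective {zero}  {zero}  _  = refl
double-injective {suc m} {suc n} eq = cong suc (double-injective (suc-injective (suc-injective eq)))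

data Transition : Phase → Set where
  advance : ∀ {d} → size (next d) ≡ size d → elapsed (next d) ≡ suc (elapsed d) → Transition d
  restart : ∀ σ → Transition (sweepL σ 0)

transition : ∀ d → Transition d
transition (sweepR p (suc r)) = advance (sym (+-suc p r)) refl
transition (sweepR p zero)    = advance (sym (+-identityʳ p)) refl
transition (sweepL σ (suc r)) = advance (sym (+-suc σ r)) (cong suc (regroup σ r))
  where
  regroup : ∀ σ r → suc σ + suc σ + r ≡ suc (σ + σ + suc r)
  regroup = solve-∀
transition (sweepL σ zero)    = restart σ

-- The current cycle began at time start; cycles of size s last 2s + 2 steps and sizes
-- double, which keeps start between 2s − 4 and 3s − 4.
record Epoch (t : ℕ) (d : Phase) : Set where
  field
    start           : ℕ
    start-trough    : mainCount (phase start) ≡ 1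
    t≡start+elapsed : t ≡ start + elapsed d
    2*size≤start+4  : 2 * size d ≤ start + 4
    start+4≤3*size  : start + 4 ≤ 3 * size d
    2≤size          : 2 ≤ size d

epoch-advance : ∀ {t d} → Epoch t d → size (next d) ≡ size d → elapsed (next d) ≡ suc (elapsed d) →
                Epoch (suc t) (next d)
epoch-advance {t} {d} e size-eq elapsed-eq = record
  { start           = start
  ; start-trough    = start-trough
  ; t≡start+elapsed = begin
      suc t                  ≡⟨ cong suc t≡start+elapsed ⟩
      suc (start + elapsed d) ≡⟨ +-suc start (elapsed d) ⟨
      start + suc (elapsed d) ≡⟨ cong (start +_) elapsed-eq ⟨
      start + elapsed (next d) ∎
  ; 2*size≤start+4  = subst (λ s → 2 * s ≤ start + 4) (sym size-eq) 2*size≤start+4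
  ; start+4≤3*size  = subst (λ s → start + 4 ≤ 3 * s) (sym size-eq) start+4≤3*size
  ; 2≤size          = subst (2 ≤_) (sym size-eq) 2≤size
  }
  where
  open Epoch e
  open ≡-Reasoning

epoch-restart : ∀ {t} σ → Epoch t (sweepL σ 0) → mainCount (phase (suc t)) ≡ 1 → Epoch (suc t) (sweepR 0 (double σ))
epoch-restart {t} σ e trough = record
  { start           = suc t
  ; start-trough    = trough
  ; t≡start+elapsed = sym (+-identityʳ (suc t))
  ; 2*size≤start+4  = proj₁ bounds
  ; start+4≤3*size  = proj₁ (proj₂ bounds)
  ; 2≤size          = proj₂ (proj₂ bounds)
  }
  where
  open Epoch e
  bounds : 2 * (0 + double σ) ≤ suc t + 4 × suc t + 4 ≤ 3 * (0 + double σ) × 2 ≤ 0 + double σ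
  bounds rewrite t≡start+elapsed | double≡+ σ =
    ≤-balance _ _ 2 2*size≤start+4 (lower start σ) ,
    ≤-balance _ _ 0 (+-mono-≤ start+4≤3*size 2≤size) (upper start σ) ,
    ≤-trans 2≤size (≤-trans (≤-reflexive (+-identityʳ σ)) (m≤m+n σ σ))
    where
    lower : ∀ s σ → 2 * (σ + σ) + (s + 4) + 2 ≡ suc (s + suc (σ + σ + 0)) + 4 + 2 * (σ + 0)
    lower = solve-∀
    upper : ∀ s σ → suc (s + suc (σ + σ + 0)) + 4 + (3 * (σ + 0) + (σ + 0)) + 0 ≡ 3 * (σ + σ) + (s + 4 + 2)
    upper = solve-∀

epoch-next : ∀ {t} d → phase t ≡ d → Epoch t d → Epoch (suc t) (next d)
epoch-next d eq e with transition d
... | advance size-eq elapsed-eq = epoch-advance e size-eq elapsed-eq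
... | restart σ                  = epoch-restart σ e (cong (mainCount ∘ next) eq)

epoch-at : ∀ t → Epoch t (phase t)
epoch-at zero    = record
  { start = 0 ; start-trough = refl ; t≡start+elapsed = refl
  ; 2*size≤start+4 = ≤-refl ; start+4≤3*size = m≤m+n 4 2 ; 2≤size = ≤-refl }
epoch-at (suc t) = epoch-next (phase t) refl (epoch-at t)

-- In a sweepR phase the peak is that of the previous cycle, of half the size;
-- in a sweepL phase it is that of the current cycle.
peakFactor : Phase → ℕ
peakFactor (sweepR _ _) = 8
peakFactor (sweepL _ _) = 2

peakFactor≤8 : ∀ d → peakFactor d ≤ 8
peakFactor≤8 (sweepR _ _) = ≤-refl
peakFactor≤8 (sweepL _ _) = m≤m+n 2 6

record Peak (t : ℕ) (d : Phase) : Set where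
  field
    peak       : ℕ
    peak≤t     : peak ≤ t
    peak-bound : size d * size d ≤ peakFactor d * mainCount (phase peak)

peak-keep : ∀ {t d d′} → Peak t d → size d′ ≡ size d → peakFactor d′ ≡ peakFactor d → Peak (suc t) d′
peak-keep {d′ = d′} pk size-eq factor-eq = record
  { peak       = peak
  ; peak≤t     = m≤n⇒m≤1+n peak≤t
  ; peak-bound = subst₂ (λ s f → s * s ≤ f * mainCount (phase peak)) (sym size-eq) (sym factor-eq) peak-bound
  }
  where open Peak pk

peak-next : ∀ {t} d → phase t ≡ d → Peak t d → Peak (suc t) (next d)
peak-next (sweepR p (suc r)) _  pk = peak-keep pk (sym (+-suc p r)) refl
peak-next {t} (sweepR p zero) eq _ = record
  { peak       = t
  ; peak≤t     = n≤1+n t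
  ; peak-bound = subst (λ d → p * p ≤ 2 * mainCount d) (sym eq) (square≤2*choose≤2 p)
  }
peak-next (sweepL σ (suc r)) _  pk = peak-keep pk (sym (+-suc σ r)) refl
peak-next (sweepL σ zero)    _  pk = record
  { peak       = peak
  ; peak≤t     = m≤n⇒m≤1+n peak≤t
  ; peak-bound = subst (λ s → s * s ≤ 8 * c) (sym (double≡+ σ))
                   (≤-balance _ _ 0 (*-monoʳ-≤ 4 peak-bound) (regroup σ c))
  }
  where
  open Peak pk
  c = mainCount (phase peak)
  regroup : ∀ σ c → (σ + σ) * (σ + σ) + 4 * (2 * c) + 0 ≡ 8 * c + 4 * ((σ + 0) * (σ + 0))
  regroup = solve-∀

peak-at : ∀ t → Peak t (phase t)
peak-at zero    = record { peak = 0 ; peak≤t = ≤-refl ; peak-bound = m≤m+n 4 4 }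
peak-at (suc t) = peak-next (phase t) refl (peak-at t)

potential : Phase → ℕ
potential d = 4 * size d + elapsed d

potential-next : ∀ d → 1 ≤ size d → potential d < potential (next d)
potential-next d size≥1 with transition d
... | advance size-eq elapsed-eq = ≤-reflexive (begin
  suc (4 * size d + elapsed d)                ≡⟨ +-suc (4 * size d) (elapsed d) ⟨
  4 * size d + suc (elapsed d)                ≡⟨ cong₂ (λ s e → 4 * s + e) size-eq elapsed-eq ⟨
  4 * size (next d) + elapsed (next d)        ∎)
  where open ≡-Reasoning
... | restart σ = subst (λ m → potential d < 4 * m + 0) (sym (double≡+ σ))
                  (≤-balance _ _ 0 (*-monoʳ-≤ 2 size≥1) (regroup σ))
  where
  regroup : ∀ σ → suc (4 * (σ + 0) + suc (σ + σ + 0)) + 2 * (σ + 0) + 0 ≡ 4 * (0 + (σ + σ)) + 0 + 2 * 1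
  regroup = solve-∀

phase-injective : ∀ {m n} → phase m ≡ phase n → m ≡ n
phase-injective eq = increasing⇒injective (potential ∘ phase)
  (λ t → potential-next (phase t) (≤-trans (s≤s z≤n) (Epoch.2≤size (epoch-at t)))) (cong potential eq)

elapsed≤ : ∀ d → elapsed d ≤ 2 * size d + 1
elapsed≤ (sweepR p r) = ≤-balance _ _ (p + r + r + 1) (z≤n {0}) (regroup p r)
  where
  regroup : ∀ p r → p + 0 + (p + r + r + 1) ≡ 2 * (p + r) + 1 + 0
  regroup = solve-∀
elapsed≤ (sweepL σ r) = ≤-balance _ _ r (z≤n {0}) (regroup σ r)
  where
  regroup : ∀ σ r → suc (σ + σ + r) + 0 + r ≡ 2 * (σ + r) + 1 + 0
  regroup = solve-∀

wordLength≤size : ∀ d → wordLength d ≤ size d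
wordLength≤size (sweepR p r) = m≤m+n p r
wordLength≤size (sweepL σ r) = m≤n+m r σ

module _ {t d} (e : Epoch t d) where
  open Epoch e

  start≤t : start ≤ t
  start≤t = subst (start ≤_) (sym t≡start+elapsed) (m≤m+n start (elapsed d))

  t≤2*start+5 : t ≤ 2 * start + 5
  t≤2*start+5 = subst (_≤ 2 * start + 5) (sym t≡start+elapsed)
    (≤-balance _ _ 0 (+-mono-≤ (elapsed≤ d) 2*size≤start+4) (regroup start (elapsed d) (size d)))
    where
    regroup : ∀ s e z → s + e + (2 * z + 1 + (s + 4)) + 0 ≡ 2 * s + 5 + (e + 2 * z)
    regroup = solve-∀

  size≤2+t : size d ≤ suc (suc t)
  size≤2+t = *-cancelˡ-≤ 2 (≤-trans 2*size≤start+4 (≤-balance _ _ t start≤t (regroup start t)))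
    where
    regroup : ∀ s t → s + 4 + t + t ≡ 2 * suc (suc t) + s
    regroup = solve-∀

  2+t≤6*size : suc (suc t) ≤ 6 * size d
  2+t≤6*size = subst (λ u → suc (suc u) ≤ 6 * size d) (sym t≡start+elapsed)
    (≤-balance _ _ (size d + 1) (+-mono-≤ (elapsed≤ d) start+4≤3*size) (regroup start (elapsed d) (size d)))
    where
    regroup : ∀ s e z → suc (suc (s + e)) + (2 * z + 1 + 3 * z) + (z + 1) ≡ 6 * z + (e + (s + 4))
    regroup = solve-∀

-- The multiway system

Letter : Set
Letter = Fin 10

String : Set
String = List Letter

pattern ca  = zero
pattern cb  = suc zero
pattern cS  = suc (suc zero)
pattern cE  = suc (suc (suc zero))
pattern cI  = suc (suc (suc (suc zero)))
pattern cW  = suc (suc (suc (suc (suc zero))))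
pattern cR₀ = suc (suc (suc (suc (suc (suc zero)))))
pattern cR₁ = suc (suc (suc (suc (suc (suc (suc zero))))))
pattern cR₂ = suc (suc (suc (suc (suc (suc (suc (suc zero)))))))
pattern cL  = suc (suc (suc (suc (suc (suc (suc (suc (suc zero))))))))

Passive : Letter → Set
Passive ca = ⊤
Passive cb = ⊤
Passive cS = ⊤
Passive cE = ⊤
Passive _  = ⊥

-- A rule is indexed by the head of its left-hand side, the only letter there that is not Passive.
data Rule : Letter → Set where
  I→W I→SR₀aaE              : Rule cI
  W→aW W→Wb                 : Rule cW
  R₀a→aR₀ R₀a→bR₁ R₀E→LE    : Rule cR₀
  R₁a→aR₁ R₁a→bR₂ R₁E→LE    : Rule cR₁
  R₂a→aR₂ R₂E→LE            : Rule cR₂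
  aL→Laa bL→Laa SL→SR₀      : Rule cL

before : ∀ {h} → Rule h → String
before aL→Laa = [ ca ]
before bL→Laa = [ cb ]
before SL→SR₀ = [ cS ]
before _      = []

after : ∀ {h} → Rule h → String
after R₀a→aR₀ = [ ca ]
after R₀a→bR₁ = [ ca ]
after R₁a→aR₁ = [ ca ]
after R₁a→bR₂ = [ ca ]
after R₂a→aR₂ = [ ca ]
after R₀E→LE  = [ cE ]
after R₁E→LE  = [ cE ]
after R₂E→LE  = [ cE ]
after _       = []

lhs : ∀ {h} → Rule h → String
lhs {h} ρ = before ρ ++ h ∷ after ρ

rhs : ∀ {h} → Rule h → String
rhs I→W      = [ cW ]
rhs I→SR₀aaE = cS ∷ cR₀ ∷ ca ∷ ca ∷ cE ∷ []
rhs W→aW     = ca ∷ cW ∷ []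
rhs W→Wb     = cW ∷ cb ∷ []
rhs R₀a→aR₀  = ca ∷ cR₀ ∷ []
rhs R₀a→bR₁  = cb ∷ cR₁ ∷ []
rhs R₁a→aR₁  = ca ∷ cR₁ ∷ []
rhs R₁a→bR₂  = cb ∷ cR₂ ∷ []
rhs R₂a→aR₂  = ca ∷ cR₂ ∷ []
rhs R₀E→LE   = cL ∷ cE ∷ []
rhs R₁E→LE   = cL ∷ cE ∷ []
rhs R₂E→LE   = cL ∷ cE ∷ []
rhs aL→Laa   = cL ∷ ca ∷ ca ∷ []
rhs bL→Laa   = cL ∷ ca ∷ ca ∷ []
rhs SL→SR₀   = cS ∷ cR₀ ∷ []

rule : ∃ Rule → String × String
rule (_ , ρ) = lhs ρ , rhs ρ

allRules : List (∃ Rule)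
allRules =
  (_ , I→W) ∷ (_ , I→SR₀aaE) ∷ (_ , W→aW) ∷ (_ , W→Wb) ∷
  (_ , R₀a→aR₀) ∷ (_ , R₀a→bR₁) ∷ (_ , R₀E→LE) ∷
  (_ , R₁a→aR₁) ∷ (_ , R₁a→bR₂) ∷ (_ , R₁E→LE) ∷
  (_ , R₂a→aR₂) ∷ (_ , R₂E→LE) ∷
  (_ , aL→Laa) ∷ (_ , bL→Laa) ∷ (_ , SL→SR₀) ∷ []

system : MultiwaySystem
system = record { k = 10 ; rules = map rule allRules ; init = [ cI ] }

rule-head-active : ∀ {h} → Rule h → ¬ Passive h
rule-head-active {ca} ()
rule-head-active {cb} ()
rule-head-active {cS} ()
rule-head-active {cE} ()
rule-head-active {suc (suc (suc (suc _)))} _ ()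

open import Data.List.Membership.DecPropositional
  (Product.≡-dec (List.≡-dec (Fin._≟_ {10})) (List.≡-dec (Fin._≟_ {10}))) using (_∈?_)

-- For a concrete rule, ρ∈ normalises to ⊤ and is filled in automatically.
fire : ∀ {h} (ρ : Rule h) {ρ∈ : True (rule (h , ρ) ∈? map rule allRules)} (x y : String) {u v} →
       u ≡ x ++ lhs ρ ++ y → v ≡ x ++ rhs ρ ++ y → Step system u v
fire ρ {ρ∈} x y eu ev = _ , toWitness ρ∈ , x , y , eu , ev

data Fires (u₁ : String) (h : Letter) (u₂ : String) : String → Set where
  fires : (ρ : Rule h) (x y : String) → u₁ ≡ x ++ before ρ → u₂ ≡ after ρ ++ y →
          Fires u₁ h u₂ (x ++ rhs ρ ++ y)

step-inversion : ∀ u₁ {h} u₂ {v} → All Passive u₁ → All Passive u₂ →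
                 Step system (u₁ ++ h ∷ u₂) v → Fires u₁ h u₂ v
step-inversion u₁ u₂ P₁ P₂ (_ , ρ∈ , x , y , eu , refl) with ∈-map⁻ rule {xs = allRules} ρ∈
... | (h , ρ) , _ , refl with split-unique (x ++ before ρ) u₁ (rule-head-active ρ) P₁ P₂ (sym (trans eu regroup))
  where
  regroup : x ++ lhs ρ ++ y ≡ (x ++ before ρ) ++ h ∷ after ρ ++ y
  regroup = trans (cong (x ++_) (++-assoc (before ρ) _ y)) (sym (++-assoc x (before ρ) _))
... | refl , refl , refl = fires ρ x y refl refl

data Word : ℕ → ℕ → String → Set where
  ε   : Word 0 0 []
  _·a : ∀ {j p w} → Word j p w → Word j (suc p) (w ∷ʳ ca)
  _·b : ∀ {j p w} → Word j p w → Word (suc j) (suc p) (w ∷ʳ cb)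

-- Only j ≤ 2 occurs; larger j are junk.
R[_] : ℕ → Letter
R[ 0 ] = cR₀
R[ 1 ] = cR₁
R[ _ ] = cR₂

a^_E : ℕ → String
a^ r E = replicate r ca ∷ʳ cE

W-string : ℕ → ℕ → String
W-string i j = replicate i ca ++ cW ∷ replicate j cb

R-string : ℕ → String → ℕ → String
R-string j w r = cS ∷ w ++ R[ j ] ∷ a^ r E

L-string : String → ℕ → String
L-string w σ = cS ∷ w ++ cL ∷ a^ double σ E

data Base (t : ℕ) : String → Set where
  base : ∀ i j → i + j ≡ t → Base t (W-string i j)

data Main : Phase → String → Set where
  inR : ∀ {j p w r} → j ≤ 2 → Word j p w → Main (sweepR p r) (R-string j w r)
  inL : ∀ {j r w σ} → j ≤ 2 → Word j r w → Main (sweepL σ r) (L-string w σ)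

State : ℕ → String → Set
State zero    v = v ≡ [ cI ]
State (suc t) v = Base t v ⊎ Main (phase t) v

replicate-passive : ∀ n {c} → Passive c → All Passive (replicate n c)
replicate-passive n = All.replicate⁺ n

word-passive : ∀ {j p w} → Word j p w → All Passive w
word-passive ε      = []
word-passive (W ·a) = All.∷ʳ⁺ (word-passive W) tt
word-passive (W ·b) = All.∷ʳ⁺ (word-passive W) tt

a^E-passive : ∀ r → All Passive (a^ r E)
a^E-passive r = All.∷ʳ⁺ (replicate-passive r tt) tt

S-word-passive : ∀ {j p w} → Word j p w → All Passive (cS ∷ w)
S-word-passive W = tt ∷ word-passive W

word-length : ∀ {j p w} → Word j p w → length w ≡ p
word-length ε               = refl
word-length (_·a {w = w} W) = trans (List.length-++ w) (trans (+-comm (length w) 1) (cong suc (word-length W)))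
word-length (_·b {w = w} W) = trans (List.length-++ w) (trans (+-comm (length w) 1) (cong suc (word-length W)))

a^E-injective : ∀ {m n} → a^ m E ≡ a^ n E → m ≡ n
a^E-injective {m} {n} eq = replicate-injective ca (∷ʳ-injectiveˡ (replicate m ca) (replicate n ca) eq)

init-step : ∀ {v} → Step system [ cI ] v → State 1 v
init-step st with step-inversion [] [] [] [] st
... | fires I→W      x _ e refl with refl ← drop-[] e = inj₁ (base 0 0 refl)
... | fires I→SR₀aaE x _ e refl with refl ← drop-[] e = inj₂ (inR z≤n ε)

base-step : ∀ {t u v} → Base t u → Step system u v → Base (suc t) v
base-step (base i j i+j≡t) st
  with step-inversion (replicate i ca) (replicate j cb) (replicate-passive i tt) (replicate-passive j tt) st
... | fires W→aW x _ e refl with refl ← drop-[] e =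
  subst (Base _) (sym (replicate-++-∷ i ca _)) (base (suc i) j (cong suc i+j≡t))
... | fires W→Wb x _ e refl with refl ← drop-[] e = base i (suc j) (trans (+-suc i j) (cong suc i+j≡t))

module _ {j p w} (j≤2 : j ≤ 2) (W : Word j p w) where

  R-keep : ∀ {r x y} → cS ∷ w ≡ x ++ [] → a^ r E ≡ ca ∷ y →
           Main (next (sweepR p r)) (x ++ ca ∷ R[ j ] ∷ y)
  R-keep {zero}  _ ()
  R-keep {suc r} e refl with refl ← drop-[] e =
    subst (Main _) (cong (cS ∷_) (∷ʳ-++ w ca _)) (inR j≤2 (W ·a))

  R-turn : ∀ {r x y} → cS ∷ w ≡ x ++ [] → a^ r E ≡ cE ∷ y →
           Main (next (sweepR p r)) (x ++ cL ∷ cE ∷ y)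
  R-turn {suc r} _ ()
  R-turn {zero}  e refl with refl ← drop-[] e = inL j≤2 W

R-write : ∀ {j p w r x y} → suc j ≤ 2 → Word j p w → cS ∷ w ≡ x ++ [] → a^ r E ≡ ca ∷ y →
          Main (next (sweepR p r)) (x ++ cb ∷ R[ suc j ] ∷ y)
R-write {r = zero}  _ _ _ ()
R-write {w = w} {r = suc r} j<2 W e refl with refl ← drop-[] e =
  subst (Main _) (cong (cS ∷_) (∷ʳ-++ w cb _)) (inR j<2 (W ·b))

L-double : ∀ {j p w σ x c} → j ≤ 2 → Word j p w → cS ≢ c → cS ∷ w ≡ x ∷ʳ c →
           Main (next (sweepL σ p)) (x ++ cL ∷ ca ∷ ca ∷ a^ double σ E)
L-double _ ε cS≢c e = contradiction (∷ʳ-injectiveʳ [] _ e) cS≢c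
L-double {x = x} j≤2 (_·a {w = w} W) _ e with refl ← ∷ʳ-injectiveˡ (cS ∷ w) x e = inL j≤2 W
L-double {x = x} j<2 (_·b {w = w} W) _ e with refl ← ∷ʳ-injectiveˡ (cS ∷ w) x e = inL (<⇒≤ j<2) W

L-restart : ∀ {j p w σ x} → Word j p w → cS ∷ w ≡ x ∷ʳ cS →
            Main (next (sweepL σ p)) (x ++ cS ∷ cR₀ ∷ a^ double σ E)
L-restart {x = x} ε e with refl ← ∷ʳ-injectiveˡ [] x e = inR z≤n ε
L-restart {x = x} (_·a {w = w} W) e with () ← ∷ʳ-injectiveʳ (cS ∷ w) x e
L-restart {x = x} (_·b {w = w} W) e with () ← ∷ʳ-injectiveʳ (cS ∷ w) x e

R-step : ∀ {j p w r v} → j ≤ 2 → Word j p w → Step system (R-string j w r) v → Main (next (sweepR p r)) v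
R-step {r = r} z≤n W st with step-inversion _ (a^ r E) (S-word-passive W) (a^E-passive r) st
... | fires R₀a→aR₀ _ _ e₁ e₂ = R-keep z≤n W e₁ e₂
... | fires R₀a→bR₁ _ _ e₁ e₂ = R-write (s≤s z≤n) W e₁ e₂
... | fires R₀E→LE  _ _ e₁ e₂ = R-turn z≤n W e₁ e₂
R-step {r = r} j≤2@(s≤s z≤n) W st with step-inversion _ (a^ r E) (S-word-passive W) (a^E-passive r) st
... | fires R₁a→aR₁ _ _ e₁ e₂ = R-keep j≤2 W e₁ e₂
... | fires R₁a→bR₂ _ _ e₁ e₂ = R-write (s≤s (s≤s z≤n)) W e₁ e₂
... | fires R₁E→LE  _ _ e₁ e₂ = R-turn j≤2 W e₁ e₂
R-step {r = r} j≤2@(s≤s (s≤s z≤n)) W st with step-inversion _ (a^ r E) (S-word-passive W) (a^E-passive r) st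
... | fires R₂a→aR₂ _ _ e₁ e₂ = R-keep j≤2 W e₁ e₂
... | fires R₂E→LE  _ _ e₁ e₂ = R-turn j≤2 W e₁ e₂

L-step : ∀ {j p w σ v} → j ≤ 2 → Word j p w → Step system (L-string w σ) v → Main (next (sweepL σ p)) v
L-step {σ = σ} j≤2 W st with step-inversion _ (a^ double σ E) (S-word-passive W) (a^E-passive (double σ)) st
... | fires aL→Laa _ _ e refl = L-double j≤2 W (λ ()) e
... | fires bL→Laa _ _ e refl = L-double j≤2 W (λ ()) e
... | fires SL→SR₀ _ _ e refl = L-restart W e

main-step : ∀ {d u v} → Main d u → Step system u v → Main (next d) v
main-step (inR j≤2 W) = R-step j≤2 W
main-step (inL j≤2 W) = L-step j≤2 W

step-sound : ∀ n {u v} → State n u → Step system u v → State (suc n) v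
step-sound zero    refl     = init-step
step-sound (suc t) (inj₁ b) = inj₁ ∘ base-step b
step-sound (suc t) (inj₂ m) = inj₂ ∘ main-step m

R-keep-fires : ∀ {j w r} → j ≤ 2 → Step system (R-string j w (suc r)) (R-string j (w ∷ʳ ca) r)
R-keep-fires {w = w} {r} z≤n               = fire R₀a→aR₀ (cS ∷ w) (a^ r E) refl (cong (cS ∷_) (∷ʳ-++ w ca _))
R-keep-fires {w = w} {r} (s≤s z≤n)         = fire R₁a→aR₁ (cS ∷ w) (a^ r E) refl (cong (cS ∷_) (∷ʳ-++ w ca _))
R-keep-fires {w = w} {r} (s≤s (s≤s z≤n))   = fire R₂a→aR₂ (cS ∷ w) (a^ r E) refl (cong (cS ∷_) (∷ʳ-++ w ca _))

R-write-fires : ∀ {j w r} → suc j ≤ 2 → Step system (R-string j w (suc r)) (R-string (suc j) (w ∷ʳ cb) r)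
R-write-fires {w = w} {r} (s≤s z≤n)       = fire R₀a→bR₁ (cS ∷ w) (a^ r E) refl (cong (cS ∷_) (∷ʳ-++ w cb _))
R-write-fires {w = w} {r} (s≤s (s≤s z≤n)) = fire R₁a→bR₂ (cS ∷ w) (a^ r E) refl (cong (cS ∷_) (∷ʳ-++ w cb _))

R-turn-fires : ∀ {j w} → j ≤ 2 → Step system (R-string j w 0) (L-string w 0)
R-turn-fires {w = w} z≤n             = fire R₀E→LE (cS ∷ w) [] refl refl
R-turn-fires {w = w} (s≤s z≤n)       = fire R₁E→LE (cS ∷ w) [] refl refl
R-turn-fires {w = w} (s≤s (s≤s z≤n)) = fire R₂E→LE (cS ∷ w) [] refl refl

L-double-fires : ∀ {w σ} → Step system (L-string (w ∷ʳ ca) σ) (L-string w (suc σ))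
L-double-fires {w} {σ} = fire aL→Laa (cS ∷ w) (a^ double σ E) (cong (cS ∷_) (∷ʳ-++ w ca _)) refl

L-restart-fires : ∀ {σ} → Step system (L-string [] σ) (R-string 0 [] (double σ))
L-restart-fires {σ} = fire SL→SR₀ [] (a^ double σ E) refl refl

base-complete : ∀ {t v} → Base (suc t) v → ∃ λ u → Base t u × Step system u v
base-complete (base (suc i) j refl) =
  W-string i j , base i j refl , fire W→aW (replicate i ca) (replicate j cb) refl (sym (replicate-++-∷ i ca _))
base-complete (base zero (suc j) refl) = W-string 0 j , base 0 j refl , fire W→Wb [] (replicate j cb) refl refl

main-complete : ∀ d {v} → Main (next d) v → ∃ λ u → Main d u × Step system u v
main-complete (sweepR p (suc r)) (inR j≤2 (W ·a)) = _ , inR j≤2 W , R-keep-fires j≤2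
main-complete (sweepR p (suc r)) (inR j<2 (W ·b)) = _ , inR (<⇒≤ j<2) W , R-write-fires j<2
main-complete (sweepR p zero)    (inL j≤2 W)      = _ , inR j≤2 W , R-turn-fires j≤2
main-complete (sweepL σ (suc r)) (inL j≤2 W)      = _ , inL j≤2 (W ·a) , L-double-fires
main-complete (sweepL σ zero)    (inR _ ε)        = _ , inL z≤n ε , L-restart-fires

step-complete : ∀ n {v} → State (suc n) v → ∃ λ u → State n u × Step system u v
step-complete zero (inj₁ (base zero zero refl))  = [ cI ] , refl , fire I→W [] [] refl refl
step-complete zero (inj₁ (base zero (suc _) ()))
step-complete zero (inj₁ (base (suc _) _ ()))
step-complete zero (inj₂ (inR _ ε))              = [ cI ] , refl , fire I→SR₀aaE [] [] refl refl
step-complete (suc t) (inj₁ b) with u , b′ , st ← base-complete b         = u , inj₁ b′ , st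
step-complete (suc t) (inj₂ m) with u , m′ , st ← main-complete (phase t) m = u , inj₂ m′ , st

reachIn⇒State : ∀ n {v} → ReachIn system n v → State n v
reachIn⇒State zero    v≡init         = v≡init
reachIn⇒State (suc n) (u , reach , st) = step-sound n (reachIn⇒State n reach) st

State⇒reachIn : ∀ n {v} → State n v → ReachIn system n v
State⇒reachIn zero    v≡init = v≡init
State⇒reachIn (suc n) s with u , s′ , st ← step-complete n s = u , State⇒reachIn n s′ , st

R-active : ∀ j → ¬ Passive R[ j ]
R-active 0             ()
R-active 1             ()
R-active (suc (suc _)) ()

R≢L : ∀ j → R[ j ] ≢ cL
R≢L 0             ()
R≢L 1             ()
R≢L (suc (suc _)) ()

R≢W : ∀ j → R[ j ] ≢ cW
R≢W 0             ()
R≢W 1             ()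
R≢W (suc (suc _)) ()

main-phase-unique : ∀ {d d′ v v′} → Main d v → Main d′ v′ → v ≡ v′ → d ≡ d′
main-phase-unique (inR {j = j} {w = w} {r} _ W) (inR {w = w′} {r′} _ W′) eq
  with refl , _ , a^E-eq ← split-unique w w′ (R-active j) (word-passive W′) (a^E-passive r′) (∷-injectiveʳ eq)
  = cong₂ sweepR (trans (sym (word-length W)) (word-length W′)) (a^E-injective a^E-eq)
main-phase-unique (inR {j = j} {w = w} _ _) (inL {w = w′} {σ′} _ W′) eq
  with _ , R≡L , _ ← split-unique w w′ (R-active j) (word-passive W′) (a^E-passive (double σ′)) (∷-injectiveʳ eq)
  = contradiction R≡L (R≢L j)
main-phase-unique (inL {w = w} _ _) (inR {j = j′} {w = w′} {r′} _ W′) eq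
  with _ , L≡R , _ ← split-unique w w′ (λ ()) (word-passive W′) (a^E-passive r′) (∷-injectiveʳ eq)
  = contradiction (sym L≡R) (R≢L j′)
main-phase-unique (inL {w = w} _ W) (inL {w = w′} {σ′} _ W′) eq
  with refl , _ , a^E-eq ← split-unique w w′ (λ ()) (word-passive W′) (a^E-passive (double σ′)) (∷-injectiveʳ eq)
  = cong₂ sweepL (double-injective (a^E-injective a^E-eq)) (trans (sym (word-length W)) (word-length W′))

base-time-unique : ∀ {t t′ v v′} → Base t v → Base t′ v′ → v ≡ v′ → t ≡ t′
base-time-unique (base i j refl) (base i′ j′ refl) eq
  with i-eq , _ , j-eq ← split-unique (replicate i ca) (replicate i′ ca) (λ ())
                           (replicate-passive i′ tt) (replicate-passive j′ tt) eq
  = cong₂ _+_ (replicate-injective ca i-eq) (replicate-injective cb j-eq)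

base≢main : ∀ {t d v v′} → Base t v → Main d v′ → v ≢ v′
base≢main (base i _ _) (inR {j = j} {w = w} {r} _ W) eq
  with _ , W≡R , _ ← split-unique (replicate i ca) (cS ∷ w) (λ ()) (S-word-passive W) (a^E-passive r) eq
  = R≢W j (sym W≡R)
base≢main (base i _ _) (inL {w = w} {σ} _ W) eq
  with _ , () , _ ← split-unique (replicate i ca) (cS ∷ w) (λ ()) (S-word-passive W) (a^E-passive (double σ)) eq

init≢base : ∀ {t v} → Base t v → [ cI ] ≢ v
init≢base (base i j _) eq
  with _ , () , _ ← split-unique [] (replicate i ca) (λ ()) (replicate-passive i tt) (replicate-passive j tt) eq

init≢main : ∀ {d v} → Main d v → [ cI ] ≢ v
init≢main (inR _ _) ()
init≢main (inL _ _) ()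

State-functional : ∀ m n {v v′} → State m v → State n v′ → v ≡ v′ → m ≡ n
State-functional zero    zero    _        _         _  = refl
State-functional zero    (suc n) refl     (inj₁ b′) eq = contradiction eq (init≢base b′)
State-functional zero    (suc n) refl     (inj₂ M′) eq = contradiction eq (init≢main M′)
State-functional (suc m) zero    (inj₁ b) refl      eq = contradiction (sym eq) (init≢base b)
State-functional (suc m) zero    (inj₂ M) refl      eq = contradiction (sym eq) (init≢main M)
State-functional (suc m) (suc n) (inj₁ b) (inj₁ b′) eq = cong suc (base-time-unique b b′ eq)
State-functional (suc m) (suc n) (inj₁ b) (inj₂ M′) eq = contradiction eq (base≢main b M′)
State-functional (suc m) (suc n) (inj₂ M) (inj₁ b′) eq = contradiction (sym eq) (base≢main b′ M)
State-functional (suc m) (suc n) (inj₂ M) (inj₂ M′) eq = cong suc (phase-injective (main-phase-unique M M′ eq))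

State⇒Gen : ∀ n {v} → State n v → Gen system (suc n) v
State⇒Gen n s = State⇒reachIn n s , λ m m<n reach → <-irrefl (State-functional m n (reachIn⇒State m reach) s refl) m<n

Gen⇒State : ∀ n {v} → Gen system (suc n) v → State n v
Gen⇒State n (reach , _) = reachIn⇒State n reach

-- Counting generations

words : ℕ → ℕ → List String
words zero    zero    = [ [] ]
words (suc j) zero    = []
words zero    (suc p) = map (_∷ʳ ca) (words zero p)
words (suc j) (suc p) = map (_∷ʳ ca) (words (suc j) p) ++ map (_∷ʳ cb) (words j p)

words-enumerate : ∀ j p → Enumerates (Word j p) (words j p)
words-enumerate zero    zero    = enumerates-≐ ((λ { refl → ε }) , λ { ε → refl }) enumerates-singleton
words-enumerate (suc j) zero    = enumerates-[] λ ()
words-enumerate zero    (suc p) = enumerates-≐ ((λ { (_ , W , refl) → W ·a }) , λ { (W ·a) → _ , W , refl })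
  (enumerates-map (_∷ʳ ca) (∷ʳ-injectiveˡ _ _) (words-enumerate zero p))
words-enumerate (suc j) (suc p) = enumerates-≐ (to , from)
  (enumerates-++ (enumerates-map (_∷ʳ ca) (∷ʳ-injectiveˡ _ _) (words-enumerate (suc j) p))
                 (enumerates-map (_∷ʳ cb) (∷ʳ-injectiveˡ _ _) (words-enumerate j p))
                 λ { (w , _ , refl) (w′ , _ , eq) → contradiction (∷ʳ-injectiveʳ w w′ eq) λ () })
  where
  to : Image (_∷ʳ ca) (Word (suc j) p) ∪ Image (_∷ʳ cb) (Word j p) ⊆ Word (suc j) (suc p)
  to (inj₁ (_ , W , refl)) = W ·a
  to (inj₂ (_ , W , refl)) = W ·b
  from : Word (suc j) (suc p) ⊆ Image (_∷ʳ ca) (Word (suc j) p) ∪ Image (_∷ʳ cb) (Word j p)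
  from (W ·a) = inj₁ (_ , W , refl)
  from (W ·b) = inj₂ (_ , W , refl)

words-length : ∀ j p → length (words j p) ≡ p C j
words-length zero    zero    = refl
words-length (suc j) zero    = refl
words-length zero    (suc p) = trans (List.length-map (_∷ʳ ca) (words zero p)) (words-length zero p)
words-length (suc j) (suc p) = begin
  length (map (_∷ʳ ca) (words (suc j) p) ++ map (_∷ʳ cb) (words j p))
    ≡⟨ List.length-++ (map (_∷ʳ ca) (words (suc j) p)) ⟩
  length (map (_∷ʳ ca) (words (suc j) p)) + length (map (_∷ʳ cb) (words j p))
    ≡⟨ cong₂ _+_ (List.length-map (_∷ʳ ca) (words (suc j) p)) (List.length-map (_∷ʳ cb) (words j p)) ⟩
  length (words (suc j) p) + length (words j p)
    ≡⟨ cong₂ _+_ (words-length (suc j) p) (words-length j p) ⟩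
  p C suc j + p C j
    ≡⟨ +-comm (p C suc j) (p C j) ⟩
  p C j + p C suc j
    ≡⟨ nCk+nC[k+1]≡[n+1]C[k+1] p j ⟩
  suc p C suc j
    ∎
  where open ≡-Reasoning

R-string-injective : ∀ {j r w w′} → R-string j w r ≡ R-string j w′ r → w ≡ w′
R-string-injective {w = w} {w′} eq = ++-cancelʳ _ w w′ (∷-injectiveʳ eq)

L-string-injective : ∀ {σ w w′} → L-string w σ ≡ L-string w′ σ → w ≡ w′
L-string-injective {w = w} {w′} eq = ++-cancelʳ _ w w′ (∷-injectiveʳ eq)

R-strings : ℕ → ℕ → ℕ → List String
R-strings j p r = map (λ w → R-string j w r) (words j p)

R-strings-enumerate : ∀ j p r → Enumerates (Image (λ w → R-string j w r) (Word j p)) (R-strings j p r)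
R-strings-enumerate j p r = enumerates-map _ R-string-injective (words-enumerate j p)

R-heads-differ : ∀ {j j′ p r v} → R[ j ] ≢ R[ j′ ] →
                 Image (λ w → R-string j w r) (Word j p) v → ¬ Image (λ w → R-string j′ w r) (Word j′ p) v
R-heads-differ {j} {r = r} R≢R′ (w , _ , refl) (w′ , W′ , eq) =
  R≢R′ (proj₁ (proj₂ (split-unique w w′ (R-active j) (word-passive W′) (a^E-passive r) (∷-injectiveʳ eq))))

b-count-unique : ∀ {j j′ p w w′} → Word j p w → Word j′ p w′ → w ≡ w′ → j ≡ j′
b-count-unique ε               ε                _  = refl
b-count-unique (_·a {w = w} W) (_·a {w = w′} W′) eq = b-count-unique W W′ (∷ʳ-injectiveˡ w w′ eq)
b-count-unique (_·a {w = w} W) (_·b {w = w′} W′) eq with () ← ∷ʳ-injectiveʳ w w′ eq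
b-count-unique (_·b {w = w} W) (_·a {w = w′} W′) eq with () ← ∷ʳ-injectiveʳ w w′ eq
b-count-unique (_·b {w = w} W) (_·b {w = w′} W′) eq = cong suc (b-count-unique W W′ (∷ʳ-injectiveˡ w w′ eq))

b-counts-differ : ∀ {j j′ p w} → j ≢ j′ → Word j p w → ¬ Word j′ p w
b-counts-differ j≢j′ W W′ = j≢j′ (b-count-unique W W′ refl)

main-states : Phase → List String
main-states (sweepR p r) = R-strings 0 p r ++ R-strings 1 p r ++ R-strings 2 p r
main-states (sweepL σ r) = map (λ w → L-string w σ) (words 0 r ++ words 1 r ++ words 2 r)

main-states-enumerate : ∀ d → Enumerates (Main d) (main-states d)
main-states-enumerate (sweepR p r) = enumerates-≐ (to , from)
  (enumerates-++ (R-strings-enumerate 0 p r)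
    (enumerates-++ (R-strings-enumerate 1 p r) (R-strings-enumerate 2 p r) (R-heads-differ λ ()))
    λ v₀ → Sum.[ R-heads-differ (λ ()) v₀ , R-heads-differ (λ ()) v₀ ])
  where
  to : _ ⊆ Main (sweepR p r)
  to (inj₁ (_ , W , refl))        = inR z≤n W
  to (inj₂ (inj₁ (_ , W , refl))) = inR (s≤s z≤n) W
  to (inj₂ (inj₂ (_ , W , refl))) = inR (s≤s (s≤s z≤n)) W
  from : Main (sweepR p r) ⊆ _
  from (inR z≤n W)             = inj₁ (_ , W , refl)
  from (inR (s≤s z≤n) W)       = inj₂ (inj₁ (_ , W , refl))
  from (inR (s≤s (s≤s z≤n)) W) = inj₂ (inj₂ (_ , W , refl))
main-states-enumerate (sweepL σ r) = enumerates-≐ (to , from)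
  (enumerates-map _ L-string-injective
    (enumerates-++ (words-enumerate 0 r)
      (enumerates-++ (words-enumerate 1 r) (words-enumerate 2 r) (b-counts-differ λ ()))
      λ W₀ → Sum.[ b-counts-differ (λ ()) W₀ , b-counts-differ (λ ()) W₀ ]))
  where
  to : _ ⊆ Main (sweepL σ r)
  to (_ , inj₁ W        , refl) = inL z≤n W
  to (_ , inj₂ (inj₁ W) , refl) = inL (s≤s z≤n) W
  to (_ , inj₂ (inj₂ W) , refl) = inL (s≤s (s≤s z≤n)) W
  from : Main (sweepL σ r) ⊆ _
  from (inL z≤n W)             = _ , inj₁ W , refl
  from (inL (s≤s z≤n) W)       = _ , inj₂ (inj₁ W) , refl
  from (inL (s≤s (s≤s z≤n)) W) = _ , inj₂ (inj₂ W) , refl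

main-states-length : ∀ d → length (main-states d) ≡ mainCount d
main-states-length (sweepR p r) = begin
  length (R-strings 0 p r ++ R-strings 1 p r ++ R-strings 2 p r)
    ≡⟨ List.length-++ (R-strings 0 p r) ⟩
  length (R-strings 0 p r) + length (R-strings 1 p r ++ R-strings 2 p r)
    ≡⟨ cong (length (R-strings 0 p r) +_) (List.length-++ (R-strings 1 p r)) ⟩
  length (R-strings 0 p r) + (length (R-strings 1 p r) + length (R-strings 2 p r))
    ≡⟨ cong₂ _+_ (R-count 0) (cong₂ _+_ (R-count 1) (R-count 2)) ⟩
  choose≤2 p
    ∎
  where
  open ≡-Reasoning
  R-count : ∀ j → length (R-strings j p r) ≡ p C j
  R-count j = trans (List.length-map _ (words j p)) (words-length j p)
main-states-length (sweepL σ r) = begin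
  length (map (λ w → L-string w σ) (words 0 r ++ words 1 r ++ words 2 r))
    ≡⟨ List.length-map _ (words 0 r ++ words 1 r ++ words 2 r) ⟩
  length (words 0 r ++ words 1 r ++ words 2 r)
    ≡⟨ List.length-++ (words 0 r) ⟩
  length (words 0 r) + length (words 1 r ++ words 2 r)
    ≡⟨ cong (length (words 0 r) +_) (List.length-++ (words 1 r)) ⟩
  length (words 0 r) + (length (words 1 r) + length (words 2 r))
    ≡⟨ cong₂ _+_ (words-length 0 r) (cong₂ _+_ (words-length 1 r) (words-length 2 r)) ⟩
  choose≤2 r
    ∎
  where open ≡-Reasoning

base-states : ℕ → List String
base-states zero    = [ W-string 0 0 ]
base-states (suc t) = W-string 0 (suc t) ∷ map (ca ∷_) (base-states t)

base-states-enumerate : ∀ t → Enumerates (Base t) (base-states t)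
base-states-enumerate zero    = enumerates-≐ ((λ { refl → base 0 0 refl }) , λ { (base 0 0 refl) → refl })
  enumerates-singleton
base-states-enumerate (suc t) = enumerates-≐ (to , from)
  (enumerates-++ enumerates-singleton (enumerates-map (ca ∷_) ∷-injectiveʳ (base-states-enumerate t))
    λ { refl (_ , _ , ()) })
  where
  to : (_≡ W-string 0 (suc t)) ∪ Image (ca ∷_) (Base t) ⊆ Base (suc t)
  to (inj₁ refl)                        = base 0 (suc t) refl
  to (inj₂ (_ , base i j i+j≡t , refl)) = base (suc i) j (cong suc i+j≡t)
  from : Base (suc t) ⊆ (_≡ W-string 0 (suc t)) ∪ Image (ca ∷_) (Base t)
  from (base zero    j j≡1+t)   = inj₁ (cong (W-string 0) j≡1+t)
  from (base (suc i) j 1+i+j≡1+t) = inj₂ (_ , base i j (suc-injective 1+i+j≡1+t) , refl)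

base-states-length : ∀ t → length (base-states t) ≡ suc t
base-states-length zero    = refl
base-states-length (suc t) = cong suc (trans (List.length-map (ca ∷_) (base-states t)) (base-states-length t))

-- The t + 1 strings a^i W b^j and the strings of the main component.
growth : ℕ → ℕ
growth zero          = 0
growth (suc zero)    = 1
growth (suc (suc t)) = suc t + mainCount (phase t)

states : ℕ → List String
states zero    = [ [ cI ] ]
states (suc t) = base-states t ++ main-states (phase t)

states-enumerate : ∀ n → Enumerates (State n) (states n)
states-enumerate zero    = enumerates-singleton
states-enumerate (suc t) = enumerates-++ (base-states-enumerate t) (main-states-enumerate (phase t))
  λ b m → base≢main b m refl

states-length : ∀ n → length (states n) ≡ growth (suc n)
states-length zero    = refl
states-length (suc t) = trans (List.length-++ (base-states t))
  (cong₂ _+_ (base-states-length t) (main-states-length (phase t)))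

-- Asymptotics of the growth function

n≤growth : ∀ n → n ≤ growth n
n≤growth zero          = z≤n
n≤growth (suc zero)    = ≤-refl
n≤growth (suc (suc t)) = subst (_≤ suc t + mainCount (phase t)) (+-comm (suc t) 1) (+-monoʳ-≤ (suc t) (s≤s z≤n))

growth-trough : ∀ {t} → mainCount (phase t) ≡ 1 → growth (suc (suc t)) ≡ suc (suc t)
growth-trough {t} trough = trans (cong (suc t +_) trough) (+-comm (suc t) 1)

growth≤square : ∀ n → growth n ≤ suc n * suc n
growth≤square zero          = z≤n
growth≤square (suc zero)    = m≤m+n 1 3
growth≤square (suc (suc t)) = begin
  suc t + mainCount (phase t)  ≤⟨ +-monoʳ-≤ (suc t) (choose≤2-bound wordLength≤n) ⟩
  suc t + (n * n + n + 2)      ≡⟨ regroup t ⟩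
  suc n * suc n                ∎
  where
  n = suc (suc t)
  wordLength≤n : wordLength (phase t) ≤ n
  wordLength≤n = ≤-trans (wordLength≤size (phase t)) (size≤2+t (epoch-at t))
  regroup : ∀ t → suc t + (suc (suc t) * suc (suc t) + suc (suc t) + 2) ≡ suc (suc (suc t)) * suc (suc (suc t))
  regroup = solve-∀
  open ≤-Reasoning

trough-below : ∀ t → ∃ λ j → growth j ≡ j × 1 ≤ j × j ≤ suc (suc t) × suc (suc t) ≤ 4 * j
trough-below t = suc (suc start) , growth-trough start-trough , s≤s z≤n , s≤s (s≤s (start≤t e)) ,
  ≤-balance _ _ (2 * start + 1) (t≤2*start+5 e) (regroup t start)
  where
  e = epoch-at t
  open Epoch e
  regroup : ∀ t s → suc (suc t) + (2 * s + 5) + (2 * s + 1) ≡ 4 * suc (suc s) + t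
  regroup = solve-∀

trough-above : ∀ n → 2 ≤ n → ∃ λ j → growth j ≡ j × n ≤ j × j ≤ 4 * n
trough-above n 2≤n = suc (suc start) , growth-trough start-trough ,
  *-cancelˡ-≤ 2 (≤-balance _ _ 0 (t≤2*start+5 e) (regroup₁ n start)) ,
  ≤-balance _ _ 1 (+-mono-≤ (start≤t e) (*-monoʳ-≤ 2 2≤n)) (regroup₂ n start)
  where
  e = epoch-at (suc (2 * n))
  open Epoch e
  regroup₁ : ∀ n s → 2 * n + (2 * s + 5) + 0 ≡ 2 * suc (suc s) + suc (2 * n)
  regroup₁ = solve-∀
  regroup₂ : ∀ n s → suc (suc s) + (suc (2 * n) + 2 * n) + 1 ≡ 4 * n + (s + 2 * 2)
  regroup₂ = solve-∀

upperEnv-quadratic : ThetaPow (upperEnv growth) 2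
upperEnv-quadratic = 288 , 4 , 2 , bounds
  where
  bounds : ∀ n → 2 ≤ n → n ^ 2 ≤ 288 * upperEnv growth n × upperEnv growth n ≤ 4 * n ^ 2
  bounds zero          ()
  bounds (suc zero)    (s≤s ())
  bounds n@(suc (suc t)) _ = lower , upper
    where
    open Peak (peak-at t)
    s = size (phase t)
    c = mainCount (phase peak)
    lower : n ^ 2 ≤ 288 * upperEnv growth n
    lower = begin
      n ^ 2                          ≡⟨ cong (n *_) (*-identityʳ n) ⟩
      n * n                          ≤⟨ *-mono-≤ (2+t≤6*size (epoch-at t)) (2+t≤6*size (epoch-at t)) ⟩
      6 * s * (6 * s)                ≡⟨ regroup s ⟩
      36 * (s * s)                   ≤⟨ *-monoʳ-≤ 36 (≤-trans peak-bound (*-monoˡ-≤ c (peakFactor≤8 (phase t)))) ⟩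
      36 * (8 * c)                   ≡⟨ *-assoc 36 8 c ⟨
      288 * c                        ≤⟨ *-monoʳ-≤ 288 (m≤n+m c (suc peak)) ⟩
      288 * growth (suc (suc peak))  ≤⟨ *-monoʳ-≤ 288 (≤-upperEnv growth n (s≤s (s≤s peak≤t))) ⟩
      288 * upperEnv growth n        ∎
      where
      regroup : ∀ s → 6 * s * (6 * s) ≡ 36 * (s * s)
      regroup = solve-∀
      open ≤-Reasoning
    upper : upperEnv growth n ≤ 4 * n ^ 2
    upper = begin
      upperEnv growth n  ≤⟨ upperEnv-least growth n growth≤ ⟩
      suc n * suc n      ≤⟨ *-mono-≤ 1+n≤2n 1+n≤2n ⟩
      (2 * n) * (2 * n)  ≡⟨ regroup n ⟩
      4 * n ^ 2          ∎
      where
      growth≤ : ∀ j → j ≤ n → growth j ≤ suc n * suc n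
      growth≤ j j≤n = ≤-trans (growth≤square j) (*-mono-≤ (s≤s j≤n) (s≤s j≤n))
      1+n≤2n : suc n ≤ 2 * n
      1+n≤2n = ≤-balance _ _ 1 (s≤s (z≤n {t})) (regroup′ t)
        where
        regroup′ : ∀ t → suc (suc (suc t)) + suc t + 1 ≡ 2 * suc (suc t) + 1
        regroup′ = solve-∀
      regroup : ∀ n → 2 * n * (2 * n) ≡ 4 * (n * (n * 1))
      regroup = solve-∀
      open ≤-Reasoning

open LowerEnvelope growth n≤growth using (lowerEnv; lowerEnv-isLowerEnv)

lowerEnv-linear : ThetaPow lowerEnv 1
lowerEnv-linear = 4 , 4 , 2 , bounds
  where
  bounds : ∀ n → 2 ≤ n → n ^ 1 ≤ 4 * lowerEnv n × lowerEnv n ≤ 4 * n ^ 1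
  bounds zero          ()
  bounds (suc zero)    (s≤s ())
  bounds n@(suc (suc t)) 2≤n with trough-below t | trough-above n 2≤n
  ... | j , fixed , 1≤j , j≤n , n≤4j | j′ , fixed′ , n≤j′ , j′≤4n =
    subst (_≤ 4 * lowerEnv n) (sym (*-identityʳ n))
      (≤-trans n≤4j (*-monoʳ-≤ 4 (fixedPoint≤lowerEnv n≤growth (lowerEnv-isLowerEnv n) 1≤j j≤n fixed))) ,
    subst (λ m → lowerEnv n ≤ 4 * m) (sym (*-identityʳ n))
      (≤-trans (lowerEnv≤fixedPoint (lowerEnv-isLowerEnv n) (s≤s z≤n) n≤j′ fixed′) j′≤4n)

growth-isGrowthFunction : IsGrowthFunction system growth
growth-isGrowthFunction zero    = [] , AllPairs.[] , (λ _ → mk⇔ (λ ()) (λ ())) , refl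
growth-isGrowthFunction (suc n) with uniq , sound , complete ← states-enumerate n =
  states n , uniq , (λ _ → mk⇔ (State⇒Gen n ∘ sound) (complete ∘ Gen⇒State n)) , states-length n

growth-unbounded : UnboundedSeq growth
growth-unbounded =
  (λ n eq → contradiction (subst (suc n ≤_) eq (n≤growth (suc n))) λ ()) ,
  λ B → suc B , n≤growth (suc B)

mainTheorem13 : Σ MultiwaySystem λ S → Σ (ℕ → ℕ) λ a → IsGrowthFunction S a × UnboundedSeq a × ThetaPow (upperEnv a) 2 × Σ (ℕ → ℕ) λ al → (∀ n → IsLowerEnv a (suc n) (al (suc n))) × ThetaPow al 1
mainTheorem13 =
  system , growth , growth-isGrowthFunction , growth-unbounded , upperEnv-quadratic ,
  lowerEnv , (λ n → lowerEnv-isLowerEnv (suc n)) , lowerEnv-linear
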